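{- The subTuring degrees of partial functions $\omega\rightharpoonup\omega$, ordered by $\leq_{\rm subT}$, form a lattice.
   Context: For a partial computable function $\Phi$ from finite sequences of natural numbers to $\{0,1\}\times\omega$ and a partial function $g\colon\subseteq\omega\to\omega$, the $g$-relative sequential computation $\Phi[g]$ is the partial function defined as follows. On input $n$, suppose oracle answers $a_0,\dots,a_{s-1}$ have been obtained so far. If $\Phi(n,a_0,\dots,a_{s-1})$ is undefined, then $\Phi[g](n)$ is undefined. If $\Phi(n,a_0,\dots,a_{s-1})=\langle 1,q\rangle$, the computation halts with output $q$. If $\Phi(n,a_0,\dots,a_{s-1})=\langle 0,q\rangle$, then $q$ is a query: if $q\in{\rm dom}(g)$ the computation continues with $a_s=g(q)$; if $q\notin{\rm dom}(g)$ the computation never halts. For partial functions $f,g\colon\subseteq\omega\to\omega$, $f\leq_{\rm subT} g$ (subTuring reducibility) means there is such a partial computable $\Phi$ with $f\subseteq\Phi[g]$, i.e. for every $n\in{\rm dom}(f)$, $\Phi[g](n)$ is defined and equals $f(n)$. The subTuring degrees are the equivalence classes under $f\equiv_{\rm subT} g$ iff $f\leq_{\rm subT} g$ and $g\leq_{\rm subT} f$, partially ordered by $\leq_{\rm subT}$. -}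

module Defs where

open import Data.Nat using (ℕ; zero; suc; _+_; _*_; _^_; _<_)
open import Data.Fin using (Fin)
open import Data.Vec using (Vec; []; _∷_; lookup)
open import Data.List using (List; []; _∷_; _++_; [_])
open import Data.Product using (Σ; _×_)
open import Relation.Binary.PropositionalEquality using (_≡_)

record PFun : Set₁ where
  field
    graph      : ℕ → ℕ → Set
    functional : ∀ {n a b} → graph n a → graph n b → a ≡ b
open PFun public

data PR : ℕ → Set where
  Z    : ∀ {n} → PR n
  S    : PR 1
  P    : ∀ {n} → Fin n → PR n
  C    : ∀ {m n} → PR m → Vec (PR n) m → PR n
  R    : ∀ {n} → PR n → PR (suc (suc n)) → PR (suc n)
  M    : ∀ {n} → PR (suc n) → PR n

mutual
  data Eval : ∀ {n} → PR n → Vec ℕ n → ℕ → Set where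
    evZ  : ∀ {n} {xs : Vec ℕ n} → Eval Z xs 0
    evS  : ∀ {x} → Eval S (x ∷ []) (suc x)
    evP  : ∀ {n} {i : Fin n} {xs} → Eval (P i) xs (lookup xs i)
    evC  : ∀ {m n} {f : PR m} {gs : Vec (PR n) m} {xs ys y} →
           EvalVec gs xs ys → Eval f ys y → Eval (C f gs) xs y
    evR0 : ∀ {n} {g : PR n} {h} {xs y} →
           Eval g xs y → Eval (R g h) (0 ∷ xs) y
    evRs : ∀ {n} {g : PR n} {h} {xs k z y} →
           Eval (R g h) (k ∷ xs) z → Eval h (k ∷ z ∷ xs) y →
           Eval (R g h) (suc k ∷ xs) y
    evM  : ∀ {n} {f : PR (suc n)} {xs k} →
           Eval f (k ∷ xs) 0 →
           (∀ j → j < k → Σ ℕ (λ v → Eval f (j ∷ xs) (suc v))) →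
           Eval (M f) xs k

  data EvalVec {n} : ∀ {m} → Vec (PR n) m → Vec ℕ n → Vec ℕ m → Set where
    ev[] : ∀ {xs} → EvalVec [] xs []
    ev∷  : ∀ {m} {g : PR n} {gs : Vec (PR n) m} {xs y ys} →
           Eval g xs y → EvalVec gs xs ys → EvalVec (g ∷ gs) xs (y ∷ ys)

-- A partial computable function ℕ ⇀ ℕ is given by a code e : PR 1,
-- with e(x) = y iff  Eval e (x ∷ []) y.

code : List ℕ → ℕ
code []       = 0
code (x ∷ xs) = 2 ^ x * (2 * code xs + 1)

-- Coding of {0,1} × ω as ω:  ⟨0,q⟩ ↦ 2q (query q),  ⟨1,q⟩ ↦ 2q+1 (halt with q).

Φ⟨_⟩ : PR 1 → List ℕ → ℕ → Set
Φ⟨ e ⟩ s v = Eval e (code s ∷ []) v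

-- g-relative sequential computation Φ[g].
-- History e g n as : the oracle answers as = a₀,…,a_{s-1} are obtained
-- in the run of Φ[g] on input n.

data History (e : PR 1) (g : PFun) (n : ℕ) : List ℕ → Set where
  h[]   : History e g n []
  hsnoc : ∀ {as q a} → History e g n as →
          Φ⟨ e ⟩ (n ∷ as) (2 * q) → graph g q a →
          History e g n (as ++ [ a ])

RelComp : PR 1 → PFun → ℕ → ℕ → Set
RelComp e g n y = Σ (List ℕ) λ as → History e g n as × Φ⟨ e ⟩ (n ∷ as) (suc (2 * y))

_≤subT_ : PFun → PFun → Set
f ≤subT g = Σ (PR 1) λ e → ∀ n y → graph f n y → RelComp e g n y

-- Joins and meets in the preorder ≤subT (equivalently, in the quotient
-- partial order of subTuring degrees).

IsJoin : PFun → PFun → PFun → Set₁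
IsJoin f g h = f ≤subT h × g ≤subT h × (∀ k → f ≤subT k → g ≤subT k → h ≤subT k)

IsMeet : PFun → PFun → PFun → Set₁
IsMeet f g h = h ≤subT f × h ≤subT g × (∀ k → k ≤subT f → k ≤subT g → k ≤subT h)

{-# OPTIONS --safe #-}
-- The join of f and g is f ⊕ g, which sends ⟨0,n⟩ to f(n) and ⟨1,n⟩ to g(n): f and g reduce
-- to it by a single query, and reductions of f and g to some h combine into one that reads
-- the tag of its input. The meet is defined at ⟨d,⟨e,n⟩⟩ with value y exactly when
-- Φ_d[f](n) = y = Φ_e[g](n); it is single-valued because relative computations are
-- deterministic. It reduces to f (and to g) by running the code d read off its input, and
-- reductions h ≤ f via d and h ≤ g via e give h ≤ meet by the single query ⟨d,⟨e,n⟩⟩.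
-- Running a code read off the input needs a universal μ-recursive function. It comes from a
-- small-step abstract machine for μ-recursive codes whose step function is primitive
-- recursive, iterated until it halts by an unbounded search.

module Submission where

open import Defs
open import Data.Empty using (⊥; ⊥-elim)
open import Data.Fin as Fin using (Fin; toℕ; #_)
open import Data.List using (List; []; _∷_; _++_; [_]; length)
open import Data.List.Properties using (length-++)
open import Data.Nat hiding (parity)
open import Data.Nat.GeneralisedArithmetic using (fold; iterate; iterate-is-fold)
open import Data.Nat.Induction using (<-rec)
open import Data.Nat.Properties
open import Data.Product using (Σ; ∃-syntax; _×_; _,_; proj₁; proj₂)
open import Data.Sum using (_⊎_; inj₁; inj₂)
open import Data.Vec using (Vec; []; _∷_; lookup; map)
open import Data.Vec.Properties using (lookup-map)
open import Function using (_∘_)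
open import Relation.Binary.Construct.Closure.ReflexiveTransitive using (Star; ε; _◅_; _◅◅_)
open import Relation.Binary.Definitions using (tri<; tri≈; tri>)
open import Relation.Binary.PropositionalEquality hiding ([_])
open import Relation.Nullary.Decidable using (True; yes; no)

-- Primitive recursive arithmetic

eval-C₁ : ∀ {m} {f : PR 1} {g : PR m} {xs y z} →
          Eval g xs y → Eval f (y ∷ []) z → Eval (C f (g ∷ [])) xs z
eval-C₁ g⇓ f⇓ = evC (ev∷ g⇓ ev[]) f⇓

eval-C₂ : ∀ {m} {f : PR 2} {g₁ g₂ : PR m} {xs y₁ y₂ z} →
          Eval g₁ xs y₁ → Eval g₂ xs y₂ → Eval f (y₁ ∷ y₂ ∷ []) z →
          Eval (C f (g₁ ∷ g₂ ∷ [])) xs z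
eval-C₂ g₁⇓ g₂⇓ f⇓ = evC (ev∷ g₁⇓ (ev∷ g₂⇓ ev[])) f⇓

eval-C₃ : ∀ {m} {f : PR 3} {g₁ g₂ g₃ : PR m} {xs y₁ y₂ y₃ z} →
          Eval g₁ xs y₁ → Eval g₂ xs y₂ → Eval g₃ xs y₃ → Eval f (y₁ ∷ y₂ ∷ y₃ ∷ []) z →
          Eval (C f (g₁ ∷ g₂ ∷ g₃ ∷ [])) xs z
eval-C₃ g₁⇓ g₂⇓ g₃⇓ f⇓ = evC (ev∷ g₁⇓ (ev∷ g₂⇓ (ev∷ g₃⇓ ev[]))) f⇓

CONST : ∀ {n} → ℕ → PR n
CONST zero    = Z
CONST (suc k) = C S (CONST k ∷ [])

eval-CONST : ∀ {n} k {xs : Vec ℕ n} → Eval (CONST k) xs k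
eval-CONST zero    = evZ
eval-CONST (suc k) = eval-C₁ (eval-CONST k) evS

ADD : PR 2
ADD = R (P (# 0)) (C S (P (# 1) ∷ []))

eval-ADD : ∀ k x → Eval ADD (k ∷ x ∷ []) (k + x)
eval-ADD zero    x = evR0 evP
eval-ADD (suc k) x = evRs (eval-ADD k x) (eval-C₁ evP evS)

MUL : PR 2
MUL = R Z (C ADD (P (# 2) ∷ P (# 1) ∷ []))

eval-MUL : ∀ k x → Eval MUL (k ∷ x ∷ []) (k * x)
eval-MUL zero    x = evR0 evZ
eval-MUL (suc k) x = evRs (eval-MUL k x) (eval-C₂ evP evP (eval-ADD x (k * x)))

POW2 : PR 1
POW2 = R (CONST 1) (C MUL (CONST 2 ∷ P (# 1) ∷ []))

eval-POW2 : ∀ k → Eval POW2 (k ∷ []) (2 ^ k)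
eval-POW2 zero    = evR0 (eval-CONST 1)
eval-POW2 (suc k) = evRs (eval-POW2 k) (eval-C₂ (eval-CONST 2) evP (eval-MUL 2 (2 ^ k)))

PRED : PR 1
PRED = R Z (P (# 0))

eval-PRED : ∀ k → Eval PRED (k ∷ []) (pred k)
eval-PRED zero    = evR0 evZ
eval-PRED (suc k) = evRs (eval-PRED k) evP

ITERATE : PR 1 → PR 2
ITERATE F = R (P (# 0)) (C F (P (# 1) ∷ []))

eval-ITERATE : ∀ {F f} → (∀ x → Eval F (x ∷ []) (f x)) →
               ∀ t x → Eval (ITERATE F) (t ∷ x ∷ []) (iterate f x t)
eval-ITERATE {F} {f} F⇓ t x =
  subst (Eval (ITERATE F) (t ∷ x ∷ [])) (iterate-is-fold x f t) (eval-fold t)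
  where
  eval-fold : ∀ t → Eval (ITERATE F) (t ∷ x ∷ []) (fold x f t)
  eval-fold zero    = evR0 evP
  eval-fold (suc t) = evRs (eval-fold t) (eval-C₁ evP (F⇓ _))

if0 : ℕ → ℕ → ℕ → ℕ
if0 zero    a b = a
if0 (suc _) a b = b

if0-pos : ∀ {c} → 0 < c → ∀ a b → if0 c a b ≡ b
if0-pos {suc c} _ a b = refl

IF0 : PR 3
IF0 = R (P (# 0)) (P (# 3))

eval-IF0 : ∀ c a b → Eval IF0 (c ∷ a ∷ b ∷ []) (if0 c a b)
eval-IF0 zero    a b = evR0 evP
eval-IF0 (suc c) a b = evRs (eval-IF0 c a b) evP

parity : ℕ → ℕ
parity zero    = 0
parity (suc k) = if0 (parity k) 1 0

PARITY : PR 1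
PARITY = R Z (C IF0 (P (# 1) ∷ CONST 1 ∷ CONST 0 ∷ []))

eval-PARITY : ∀ k → Eval PARITY (k ∷ []) (parity k)
eval-PARITY zero    = evR0 evZ
eval-PARITY (suc k) =
  evRs (eval-PARITY k) (eval-C₃ evP (eval-CONST 1) (eval-CONST 0) (eval-IF0 (parity k) 1 0))

half : ℕ → ℕ
half zero    = 0
half (suc k) = half k + parity k

HALF : PR 1
HALF = R Z (C ADD (P (# 1) ∷ C PARITY (P (# 0) ∷ []) ∷ []))

eval-HALF : ∀ k → Eval HALF (k ∷ []) (half k)
eval-HALF zero    = evR0 evZ
eval-HALF (suc k) =
  evRs (eval-HALF k) (eval-C₂ evP (eval-C₁ evP (eval-PARITY k)) (eval-ADD (half k) (parity k)))

halveIfEven : ℕ → ℕ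
halveIfEven s = if0 (parity s) (half s) s

HALVE-IF-EVEN : PR 1
HALVE-IF-EVEN = C IF0 (C PARITY (P (# 0) ∷ []) ∷ C HALF (P (# 0) ∷ []) ∷ P (# 0) ∷ [])

eval-HALVE-IF-EVEN : ∀ s → Eval HALVE-IF-EVEN (s ∷ []) (halveIfEven s)
eval-HALVE-IF-EVEN s =
  eval-C₃ (eval-C₁ evP (eval-PARITY s)) (eval-C₁ evP (eval-HALF s)) evP
          (eval-IF0 (parity s) (half s) s)

oddPart : ℕ → ℕ → ℕ
oddPart t c = iterate halveIfEven c t

evenSteps : ℕ → ℕ → ℕ
evenSteps zero    c = 0
evenSteps (suc t) c = evenSteps t c + if0 (parity (oddPart t c)) 1 0

EVEN-STEPS : PR 2
EVEN-STEPS = R Z (C ADD (P (# 1) ∷ isEven ∷ []))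
  where
  isEven : PR 3
  isEven = C IF0 (C PARITY (C (ITERATE HALVE-IF-EVEN) (P (# 0) ∷ P (# 2) ∷ []) ∷ []) ∷
                  CONST 1 ∷ CONST 0 ∷ [])

eval-EVEN-STEPS : ∀ t c → Eval EVEN-STEPS (t ∷ c ∷ []) (evenSteps t c)
eval-EVEN-STEPS zero    c = evR0 evZ
eval-EVEN-STEPS (suc t) c = evRs (eval-EVEN-STEPS t c)
  (eval-C₂ evP
     (eval-C₃ (eval-C₁ (eval-C₂ evP evP (eval-ITERATE eval-HALVE-IF-EVEN t c))
                       (eval-PARITY (oddPart t c)))
              (eval-CONST 1) (eval-CONST 0) (eval-IF0 _ 1 0))
     (eval-ADD (evenSteps t c) _))

-- Pairing

parity-double : ∀ m → parity (m + m) ≡ 0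
parity-double zero    = refl
parity-double (suc m) rewrite +-suc m m | parity-double m = refl

half-double     : ∀ m → half (m + m) ≡ m
half-suc-double : ∀ m → half (suc (m + m)) ≡ m
half-double zero    = refl
half-double (suc m) rewrite +-suc m m | half-suc-double m | parity-double m = +-comm m 1
half-suc-double m rewrite half-double m | parity-double m = +-identityʳ m

2*n+1≡suc[n+n] : ∀ n → 2 * n + 1 ≡ suc (n + n)
2*n+1≡suc[n+n] n = trans (+-comm (2 * n) 1) (cong (λ m → suc (n + m)) (+-identityʳ n))

n<2^n : ∀ n → n < 2 ^ n
n<2^n zero    = s≤s z≤n
n<2^n (suc n) = +-mono-≤-< (m^n>0 2 n) (≤-trans (n<2^n n) (m≤m+n (2 ^ n) 0))

module TwoAdic (b : ℕ) where

  X : ℕ → ℕ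
  X a = 2 ^ a * suc (b + b)

  X-zero : X 0 ≡ suc (b + b)
  X-zero = *-identityˡ (suc (b + b))

  X-suc : ∀ a → X (suc a) ≡ X a + X a
  X-suc a = trans (*-assoc 2 (2 ^ a) _) (cong (X a +_) (+-identityʳ (X a)))

  parity-X : ∀ c → parity (X c) ≡ if0 c 1 0
  parity-X zero    = trans (cong parity X-zero) (cong (λ p → if0 p 1 0) (parity-double b))
  parity-X (suc c) rewrite X-suc c = parity-double (X c)

  halveIfEven-X : ∀ c → halveIfEven (X c) ≡ X (pred c)
  halveIfEven-X zero    rewrite parity-X 0 = refl
  halveIfEven-X (suc c) rewrite parity-X (suc c) = trans (cong half (X-suc c)) (half-double (X c))

  oddPart-X : ∀ a t → oddPart t (X a) ≡ X (a ∸ t)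
  oddPart-X a zero    = refl
  oddPart-X a (suc t) = begin
    oddPart t (halveIfEven (X a)) ≡⟨ cong (oddPart t) (halveIfEven-X a) ⟩
    oddPart t (X (pred a))        ≡⟨ oddPart-X (pred a) t ⟩
    X (pred a ∸ t)                ≡⟨ cong X (∸-+-assoc a 1 t) ⟩
    X (a ∸ suc t)                 ∎
    where open ≡-Reasoning

  evenSteps-X-≤ : ∀ a t → t ≤ a → evenSteps t (X a) ≡ t
  evenSteps-X-≤ a zero    _   = refl
  evenSteps-X-≤ a (suc t) t<a
    rewrite evenSteps-X-≤ a t (<⇒≤ t<a) | oddPart-X a t | parity-X (a ∸ t)
    with a ∸ t | m<n⇒0<n∸m t<a
  ... | suc _ | _ = +-comm t 1

  evenSteps-X-+ : ∀ a d → evenSteps (a + d) (X a) ≡ a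
  evenSteps-X-+ a zero    rewrite +-identityʳ a = evenSteps-X-≤ a a ≤-refl
  evenSteps-X-+ a (suc d)
    rewrite +-suc a d | evenSteps-X-+ a d | oddPart-X a (a + d)
          | m≤n⇒m∸n≡0 (m≤m+n a d) | parity-X 0 = +-identityʳ a

  a≤X : ∀ a → a ≤ X a
  a≤X a = ≤-trans (<⇒≤ (n<2^n a)) (m≤m*n (2 ^ a) (suc (b + b)))

-- pair a b = 2^a (2b+1), so that code (x ∷ xs) ≡ pair x (code xs). Halving c while it is
-- even reaches its odd part within c steps, so π₁ c, the number of halvings among the first
-- c steps, is the exponent of 2 in c. The block is opaque so that normalisation never
-- unfolds this arithmetic.
opaque
  pair : ℕ → ℕ → ℕ
  pair a b = TwoAdic.X b a

  π₁ π₂ : ℕ → ℕ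
  π₁ c = evenSteps c c
  π₂ c = half (oddPart c c)

  π₁-pair : ∀ a b → π₁ (pair a b) ≡ a
  π₁-pair a b =
    let d , a+d≡X = m≤n⇒∃[o]m+o≡n (a≤X a)
    in trans (cong (λ t → evenSteps t (X a)) (sym a+d≡X)) (evenSteps-X-+ a d)
    where open TwoAdic b

  π₂-pair : ∀ a b → π₂ (pair a b) ≡ b
  π₂-pair a b = begin
    half (oddPart (X a) (X a)) ≡⟨ cong half (oddPart-X a (X a)) ⟩
    half (X (a ∸ X a))         ≡⟨ cong (half ∘ X) (m≤n⇒m∸n≡0 (a≤X a)) ⟩
    half (X 0)                 ≡⟨ cong half X-zero ⟩
    half (suc (b + b))         ≡⟨ half-suc-double b ⟩
    b                          ∎
    where open TwoAdic b
          open ≡-Reasoning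

  pair>0 : ∀ a b → 0 < pair a b
  pair>0 a b = *-mono-< (m^n>0 2 a) z<s

  code-∷ : ∀ x xs → code (x ∷ xs) ≡ pair x (code xs)
  code-∷ x xs = cong (2 ^ x *_) (2*n+1≡suc[n+n] (code xs))

  PAIR : PR 2
  PAIR = C MUL (C POW2 (P (# 0) ∷ []) ∷ C S (C ADD (P (# 1) ∷ P (# 1) ∷ []) ∷ []) ∷ [])

  eval-PAIR : ∀ a b → Eval PAIR (a ∷ b ∷ []) (pair a b)
  eval-PAIR a b = eval-C₂ (eval-C₁ evP (eval-POW2 a)) (eval-C₁ (eval-C₂ evP evP (eval-ADD b b)) evS)
                          (eval-MUL (2 ^ a) _)

  Π₁ Π₂ : PR 1
  Π₁ = C EVEN-STEPS (P (# 0) ∷ P (# 0) ∷ [])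
  Π₂ = C HALF (C (ITERATE HALVE-IF-EVEN) (P (# 0) ∷ P (# 0) ∷ []) ∷ [])

  eval-Π₁ : ∀ c → Eval Π₁ (c ∷ []) (π₁ c)
  eval-Π₁ c = eval-C₂ evP evP (eval-EVEN-STEPS c c)

  eval-Π₂ : ∀ c → Eval Π₂ (c ∷ []) (π₂ c)
  eval-Π₂ c = eval-C₁ (eval-C₂ evP evP (eval-ITERATE eval-HALVE-IF-EVEN c c)) (eval-HALF _)

-- Expressions and their symbolic evaluation

data Exp (n : ℕ) : Set where
  `var                       : Fin n → Exp n
  `lit                       : ℕ → Exp n
  `suc `pred `double `π₁ `π₂ : Exp n → Exp n
  `pair `π₂^                 : Exp n → Exp n → Exp n
  `if0                       : Exp n → Exp n → Exp n → Exp n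

⟦_⟧ : ∀ {n} → Exp n → Vec ℕ n → ℕ
⟦ `var i      ⟧ ρ = lookup ρ i
⟦ `lit k      ⟧ ρ = k
⟦ `suc t      ⟧ ρ = suc (⟦ t ⟧ ρ)
⟦ `pred t     ⟧ ρ = pred (⟦ t ⟧ ρ)
⟦ `double t   ⟧ ρ = 2 * ⟦ t ⟧ ρ
⟦ `π₁ t       ⟧ ρ = π₁ (⟦ t ⟧ ρ)
⟦ `π₂ t       ⟧ ρ = π₂ (⟦ t ⟧ ρ)
⟦ `pair t u   ⟧ ρ = pair (⟦ t ⟧ ρ) (⟦ u ⟧ ρ)
⟦ `π₂^ i t    ⟧ ρ = iterate π₂ (⟦ t ⟧ ρ) (⟦ i ⟧ ρ)
⟦ `if0 t u v  ⟧ ρ = if0 (⟦ t ⟧ ρ) (⟦ u ⟧ ρ) (⟦ v ⟧ ρ)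

compile : ∀ {n} → Exp n → PR n
compile (`var i)     = P i
compile (`lit k)     = CONST k
compile (`suc t)     = C S (compile t ∷ [])
compile (`pred t)    = C PRED (compile t ∷ [])
compile (`double t)  = C MUL (CONST 2 ∷ compile t ∷ [])
compile (`π₁ t)      = C Π₁ (compile t ∷ [])
compile (`π₂ t)      = C Π₂ (compile t ∷ [])
compile (`pair t u)  = C PAIR (compile t ∷ compile u ∷ [])
compile (`π₂^ i t)   = C (ITERATE Π₂) (compile i ∷ compile t ∷ [])
compile (`if0 t u v) = C IF0 (compile t ∷ compile u ∷ compile v ∷ [])

eval-compile : ∀ {n} (t : Exp n) ρ → Eval (compile t) ρ (⟦ t ⟧ ρ)
eval-compile (`var i)     ρ = evP
eval-compile (`lit k)     ρ = eval-CONST k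
eval-compile (`suc t)     ρ = eval-C₁ (eval-compile t ρ) evS
eval-compile (`pred t)    ρ = eval-C₁ (eval-compile t ρ) (eval-PRED _)
eval-compile (`double t)  ρ = eval-C₂ (eval-CONST 2) (eval-compile t ρ) (eval-MUL 2 _)
eval-compile (`π₁ t)      ρ = eval-C₁ (eval-compile t ρ) (eval-Π₁ _)
eval-compile (`π₂ t)      ρ = eval-C₁ (eval-compile t ρ) (eval-Π₂ _)
eval-compile (`pair t u)  ρ = eval-C₂ (eval-compile t ρ) (eval-compile u ρ) (eval-PAIR _ _)
eval-compile (`π₂^ i t)   ρ =
  eval-C₂ (eval-compile i ρ) (eval-compile t ρ) (eval-ITERATE eval-Π₂ _ _)
eval-compile (`if0 t u v) ρ =
  eval-C₃ (eval-compile t ρ) (eval-compile u ρ) (eval-compile v ρ) (eval-IF0 _ _ _)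

data PairView {n} : Exp n → Set where
  isPair : ∀ a b → PairView (`pair a b)
  other  : ∀ {t} → PairView t

pairView : ∀ {n} (t : Exp n) → PairView t
pairView (`pair a b) = isPair a b
pairView t           = other

data PredView {n} : Exp n → Set where
  isLit : ∀ k → PredView (`lit k)
  isSuc : ∀ t → PredView (`suc t)
  other : ∀ {t} → PredView t

predView : ∀ {n} (t : Exp n) → PredView t
predView (`lit k) = isLit k
predView (`suc t) = isSuc t
predView t        = other

data SignView {n} : Exp n → Set where
  isZero     : SignView (`lit 0)
  isPositive : ∀ {t} → (∀ ρ → 0 < ⟦ t ⟧ ρ) → SignView t
  other      : ∀ {t} → SignView t

signView : ∀ {n} (t : Exp n) → SignView t
signView (`lit zero)    = isZero
signView (`lit (suc k)) = isPositive λ _ → z<s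
signView (`suc t)       = isPositive λ _ → z<s
signView (`pair a b)    = isPositive λ ρ → pair>0 (⟦ a ⟧ ρ) (⟦ b ⟧ ρ)
signView t              = other

π₁ˢ π₂ˢ predˢ : ∀ {n} → Exp n → Exp n
π₁ˢ t with pairView t
... | isPair a _ = a
... | other      = `π₁ t
π₂ˢ t with pairView t
... | isPair _ b = b
... | other      = `π₂ t
predˢ t with predView t
... | isLit k = `lit (pred k)
... | isSuc u = u
... | other   = `pred t

if0ˢ : ∀ {n} → Exp n → Exp n → Exp n → Exp n
if0ˢ t u v with signView t
... | isZero       = u
... | isPositive _ = v
... | other        = `if0 t u v

-- By its soundness ⟦⟨⟩⟧, each transition of the machine below is checked by normalising
-- the step program on a state built from variables.
_⟨_⟩ : ∀ {m n} → Exp m → Vec (Exp n) m → Exp n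
`var i     ⟨ σ ⟩ = lookup σ i
`lit k     ⟨ σ ⟩ = `lit k
`suc t     ⟨ σ ⟩ = `suc (t ⟨ σ ⟩)
`pred t    ⟨ σ ⟩ = predˢ (t ⟨ σ ⟩)
`double t  ⟨ σ ⟩ = `double (t ⟨ σ ⟩)
`π₁ t      ⟨ σ ⟩ = π₁ˢ (t ⟨ σ ⟩)
`π₂ t      ⟨ σ ⟩ = π₂ˢ (t ⟨ σ ⟩)
`pair t u  ⟨ σ ⟩ = `pair (t ⟨ σ ⟩) (u ⟨ σ ⟩)
`π₂^ i t   ⟨ σ ⟩ = `π₂^ (i ⟨ σ ⟩) (t ⟨ σ ⟩)
`if0 t u v ⟨ σ ⟩ = if0ˢ (t ⟨ σ ⟩) (u ⟨ σ ⟩) (v ⟨ σ ⟩)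

module _ {n} (ρ : Vec ℕ n) where

  ⟦π₁ˢ⟧ : ∀ t → ⟦ π₁ˢ t ⟧ ρ ≡ π₁ (⟦ t ⟧ ρ)
  ⟦π₁ˢ⟧ t with pairView t
  ... | isPair a b = sym (π₁-pair _ _)
  ... | other      = refl

  ⟦π₂ˢ⟧ : ∀ t → ⟦ π₂ˢ t ⟧ ρ ≡ π₂ (⟦ t ⟧ ρ)
  ⟦π₂ˢ⟧ t with pairView t
  ... | isPair a b = sym (π₂-pair _ _)
  ... | other      = refl

  ⟦predˢ⟧ : ∀ t → ⟦ predˢ t ⟧ ρ ≡ pred (⟦ t ⟧ ρ)
  ⟦predˢ⟧ t with predView t
  ... | isLit k = refl
  ... | isSuc u = refl
  ... | other   = refl

  ⟦if0ˢ⟧ : ∀ t u v → ⟦ if0ˢ t u v ⟧ ρ ≡ if0 (⟦ t ⟧ ρ) (⟦ u ⟧ ρ) (⟦ v ⟧ ρ)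
  ⟦if0ˢ⟧ t u v with signView t
  ... | isZero         = refl
  ... | isPositive t>0 = sym (if0-pos (t>0 ρ) _ _)
  ... | other          = refl

⟦⟨⟩⟧ : ∀ {m n} (t : Exp m) (σ : Vec (Exp n) m) ρ → ⟦ t ⟨ σ ⟩ ⟧ ρ ≡ ⟦ t ⟧ (map (λ u → ⟦ u ⟧ ρ) σ)
⟦⟨⟩⟧ (`var i)     σ ρ = sym (lookup-map i _ σ)
⟦⟨⟩⟧ (`lit k)     σ ρ = refl
⟦⟨⟩⟧ (`suc t)     σ ρ = cong suc (⟦⟨⟩⟧ t σ ρ)
⟦⟨⟩⟧ (`pred t)    σ ρ = trans (⟦predˢ⟧ ρ (t ⟨ σ ⟩)) (cong pred (⟦⟨⟩⟧ t σ ρ))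
⟦⟨⟩⟧ (`double t)  σ ρ = cong (2 *_) (⟦⟨⟩⟧ t σ ρ)
⟦⟨⟩⟧ (`π₁ t)      σ ρ = trans (⟦π₁ˢ⟧ ρ (t ⟨ σ ⟩)) (cong π₁ (⟦⟨⟩⟧ t σ ρ))
⟦⟨⟩⟧ (`π₂ t)      σ ρ = trans (⟦π₂ˢ⟧ ρ (t ⟨ σ ⟩)) (cong π₂ (⟦⟨⟩⟧ t σ ρ))
⟦⟨⟩⟧ (`pair t u)  σ ρ = cong₂ pair (⟦⟨⟩⟧ t σ ρ) (⟦⟨⟩⟧ u σ ρ)
⟦⟨⟩⟧ (`π₂^ i t)   σ ρ = cong₂ (iterate π₂) (⟦⟨⟩⟧ t σ ρ) (⟦⟨⟩⟧ i σ ρ)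
⟦⟨⟩⟧ (`if0 t u v) σ ρ
  rewrite ⟦if0ˢ⟧ ρ (t ⟨ σ ⟩) (u ⟨ σ ⟩) (v ⟨ σ ⟩) | ⟦⟨⟩⟧ t σ ρ | ⟦⟨⟩⟧ u σ ρ | ⟦⟨⟩⟧ v σ ρ = refl

symbolic : ∀ {n} (t : Exp 1) (σ : Exp n) ρ → ⟦ t ⟧ (⟦ σ ⟧ ρ ∷ []) ≡ ⟦ t ⟨ σ ∷ [] ⟩ ⟧ ρ
symbolic t σ ρ = sym (⟦⟨⟩⟧ t (σ ∷ []) ρ)

-- An abstract machine for μ-recursive codes

mutual
  ⌜_⌝ : ∀ {n} → PR n → ℕ
  ⌜ Z ⌝      = pair 0 0
  ⌜ S ⌝      = pair 1 0
  ⌜ P i ⌝    = pair 2 (toℕ i)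
  ⌜ C f gs ⌝ = pair 3 (pair ⌜ f ⌝ ⌜ gs ⌝*)
  ⌜ R g h ⌝  = pair 4 (pair ⌜ g ⌝ ⌜ h ⌝)
  ⌜ M f ⌝    = pair 5 ⌜ f ⌝

  ⌜_⌝* : ∀ {n m} → Vec (PR n) m → ℕ
  ⌜ [] ⌝*     = 0
  ⌜ g ∷ gs ⌝* = pair ⌜ g ⌝ ⌜ gs ⌝*

⌜_⌝ⱽ : ∀ {n} → Vec ℕ n → ℕ
⌜ [] ⌝ⱽ     = 0
⌜ x ∷ xs ⌝ⱽ = pair x ⌜ xs ⌝ⱽ

lookup-⌜⌝ⱽ : ∀ {n} (xs : Vec ℕ n) i → π₁ (iterate π₂ ⌜ xs ⌝ⱽ (toℕ i)) ≡ lookup xs i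
lookup-⌜⌝ⱽ (x ∷ xs) Fin.zero    = π₁-pair x ⌜ xs ⌝ⱽ
lookup-⌜⌝ⱽ (x ∷ xs) (Fin.suc i) =
  trans (cong (λ l → π₁ (iterate π₂ l (toℕ i))) (π₂-pair x ⌜ xs ⌝ⱽ)) (lookup-⌜⌝ⱽ xs i)

-- A state evaluates a code on an encoded argument tuple, evaluates a list of codes, or
-- returns a value; K is a stack of frames (0 when empty) saying what to do with that value.
evalSt evalVecSt : ℕ → ℕ → ℕ → ℕ
evalSt    e xs K = pair 0 (pair e (pair xs K))
evalVecSt L xs K = pair 1 (pair L (pair xs K))

returnSt : ℕ → ℕ → ℕ
returnSt v K = pair 2 (pair v K)

push : ℕ → ℕ → ℕ
push = pair

argsFr : ℕ → ℕ → ℕ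
argsFr L xs = pair 0 (pair L xs)

consFr callFr : ℕ → ℕ
consFr u = pair 1 u
callFr f = pair 2 f

recFr searchFr : ℕ → ℕ → ℕ → ℕ
recFr h k xs    = pair 3 (pair h (pair k xs))
searchFr f j xs = pair 4 (pair f (pair j xs))

module _ {n : ℕ} where

  `evalSt `evalVecSt : Exp n → Exp n → Exp n → Exp n
  `evalSt    e xs K = `pair (`lit 0) (`pair e (`pair xs K))
  `evalVecSt L xs K = `pair (`lit 1) (`pair L (`pair xs K))

  `returnSt `push `argsFr : Exp n → Exp n → Exp n
  `returnSt v K = `pair (`lit 2) (`pair v K)
  `push         = `pair
  `argsFr L xs  = `pair (`lit 0) (`pair L xs)

  `consFr `callFr : Exp n → Exp n
  `consFr u = `pair (`lit 1) u
  `callFr f = `pair (`lit 2) f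

  `recFr `searchFr : Exp n → Exp n → Exp n → Exp n
  `recFr h k xs    = `pair (`lit 3) (`pair h (`pair k xs))
  `searchFr f j xs = `pair (`lit 4) (`pair f (`pair j xs))

  `switch : Exp n → List (Exp n) → Exp n
  `switch t []           = `lit 0
  `switch t (b ∷ [])     = b
  `switch t (b ∷ c ∷ bs) = `if0 t b (`switch (`pred t) (c ∷ bs))

  `#_ : ∀ m {m<n : True (m <? n)} → Exp n
  `#_ m {m<n} = `var (#_ m {m<n = m<n})

state : Exp 1
state = `# 0

evalStep : Exp 1
evalStep = `switch (`π₁ e)
  ( `returnSt (`lit 0) K
  ∷ `returnSt (`suc (`π₁ xs)) K
  ∷ `returnSt (`π₁ (`π₂^ arg xs)) K
  ∷ `evalVecSt (`π₂ arg) xs (`push (`callFr (`π₁ arg)) K)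
  ∷ `if0 (`π₁ xs) (`evalSt (`π₁ arg) (`π₂ xs) K)
      (`evalSt e (`pair k (`π₂ xs)) (`push (`recFr (`π₂ arg) k (`π₂ xs)) K))
  ∷ `evalSt arg (`pair (`lit 0) xs) (`push (`searchFr arg (`lit 0) xs) K)
  ∷ [] )
  where
  e xs K arg k : Exp 1
  e   = `π₁ (`π₂ state)
  xs  = `π₁ (`π₂ (`π₂ state))
  K   = `π₂ (`π₂ (`π₂ state))
  arg = `π₂ e
  k   = `pred (`π₁ xs)

evalVecStep : Exp 1
evalVecStep = `if0 L (`returnSt (`lit 0) K)
                     (`evalSt (`π₁ L) xs (`push (`argsFr (`π₂ L) xs) K))
  where
  L xs K : Exp 1
  L  = `π₁ (`π₂ state)
  xs = `π₁ (`π₂ (`π₂ state))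
  K  = `π₂ (`π₂ (`π₂ state))

returnStep : Exp 1
returnStep = `if0 K state (`switch (`π₁ F)
  ( `evalVecSt (`π₁ d) (`π₂ d) (`push (`consFr v) K′)
  ∷ `returnSt (`pair d v) K′
  ∷ `evalSt d v K′
  ∷ `evalSt (`π₁ d) (`pair (`π₁ (`π₂ d)) (`pair v (`π₂ (`π₂ d)))) K′
  ∷ `if0 v (`returnSt (`π₁ (`π₂ d)) K′)
      (`evalSt (`π₁ d) (`pair j (`π₂ (`π₂ d))) (`push (`searchFr (`π₁ d) j (`π₂ (`π₂ d))) K′))
  ∷ [] ))
  where
  v K F K′ d j : Exp 1
  v  = `π₁ (`π₂ state)
  K  = `π₂ (`π₂ state)
  F  = `π₁ K
  K′ = `π₂ K
  d  = `π₂ F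
  j  = `suc (`π₁ (`π₂ d))

step : Exp 1
step = `switch (`π₁ state) (evalStep ∷ evalVecStep ∷ returnStep ∷ [])

stepℕ : ℕ → ℕ
stepℕ s = ⟦ step ⟧ (s ∷ [])

evalSt-Z : ∀ {n} xs K → stepℕ (evalSt ⌜ Z {n} ⌝ xs K) ≡ returnSt 0 K
evalSt-Z xs K =
  symbolic step (`evalSt (`pair (`lit 0) (`lit 0)) (`# 0) (`# 1)) (xs ∷ K ∷ [])

evalSt-S : ∀ x K → stepℕ (evalSt ⌜ S ⌝ ⌜ x ∷ [] ⌝ⱽ K) ≡ returnSt (suc x) K
evalSt-S x K =
  symbolic step (`evalSt (`pair (`lit 1) (`lit 0)) (`pair (`# 0) (`lit 0)) (`# 1)) (x ∷ K ∷ [])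

evalSt-P : ∀ {n} (i : Fin n) xs K →
           stepℕ (evalSt ⌜ P i ⌝ xs K) ≡ returnSt (π₁ (iterate π₂ xs (toℕ i))) K
evalSt-P i xs K =
  symbolic step (`evalSt (`pair (`lit 2) (`# 0)) (`# 1) (`# 2)) (toℕ i ∷ xs ∷ K ∷ [])

evalSt-C : ∀ {m n} (f : PR m) (gs : Vec (PR n) m) xs K →
           stepℕ (evalSt ⌜ C f gs ⌝ xs K) ≡ evalVecSt ⌜ gs ⌝* xs (push (callFr ⌜ f ⌝) K)
evalSt-C f gs xs K =
  symbolic step (`evalSt (`pair (`lit 3) (`pair (`# 0) (`# 1))) (`# 2) (`# 3))
                (⌜ f ⌝ ∷ ⌜ gs ⌝* ∷ xs ∷ K ∷ [])

evalSt-R-zero : ∀ {n} (g : PR n) h xs K →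
                stepℕ (evalSt ⌜ R g h ⌝ (pair 0 xs) K) ≡ evalSt ⌜ g ⌝ xs K
evalSt-R-zero g h xs K =
  symbolic step (`evalSt (`pair (`lit 4) (`pair (`# 0) (`# 1))) (`pair (`lit 0) (`# 2)) (`# 3))
                (⌜ g ⌝ ∷ ⌜ h ⌝ ∷ xs ∷ K ∷ [])

evalSt-R-suc : ∀ {n} (g : PR n) h k xs K →
               stepℕ (evalSt ⌜ R g h ⌝ (pair (suc k) xs) K)
                 ≡ evalSt ⌜ R g h ⌝ (pair k xs) (push (recFr ⌜ h ⌝ k xs) K)
evalSt-R-suc g h k xs K =
  symbolic step (`evalSt (`pair (`lit 4) (`pair (`# 0) (`# 1))) (`pair (`suc (`# 2)) (`# 3)) (`# 4))
                (⌜ g ⌝ ∷ ⌜ h ⌝ ∷ k ∷ xs ∷ K ∷ [])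

evalSt-M : ∀ {n} (f : PR (suc n)) xs K →
           stepℕ (evalSt ⌜ M f ⌝ xs K) ≡ evalSt ⌜ f ⌝ (pair 0 xs) (push (searchFr ⌜ f ⌝ 0 xs) K)
evalSt-M f xs K =
  symbolic step (`evalSt (`pair (`lit 5) (`# 0)) (`# 1) (`# 2)) (⌜ f ⌝ ∷ xs ∷ K ∷ [])

evalVecSt-[] : ∀ xs K → stepℕ (evalVecSt 0 xs K) ≡ returnSt 0 K
evalVecSt-[] xs K = symbolic step (`evalVecSt (`lit 0) (`# 0) (`# 1)) (xs ∷ K ∷ [])

evalVecSt-∷ : ∀ {n m} (g : PR n) (gs : Vec (PR n) m) xs K →
            stepℕ (evalVecSt ⌜ g ∷ gs ⌝* xs K) ≡ evalSt ⌜ g ⌝ xs (push (argsFr ⌜ gs ⌝* xs) K)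
evalVecSt-∷ g gs xs K =
  symbolic step (`evalVecSt (`pair (`# 0) (`# 1)) (`# 2) (`# 3)) (⌜ g ⌝ ∷ ⌜ gs ⌝* ∷ xs ∷ K ∷ [])

returnSt-args : ∀ v L xs K →
                stepℕ (returnSt v (push (argsFr L xs) K)) ≡ evalVecSt L xs (push (consFr v) K)
returnSt-args v L xs K =
  symbolic step (`returnSt (`# 0) (`push (`argsFr (`# 1) (`# 2)) (`# 3))) (v ∷ L ∷ xs ∷ K ∷ [])

returnSt-cons : ∀ v u K → stepℕ (returnSt v (push (consFr u) K)) ≡ returnSt (pair u v) K
returnSt-cons v u K =
  symbolic step (`returnSt (`# 0) (`push (`consFr (`# 1)) (`# 2))) (v ∷ u ∷ K ∷ [])

returnSt-call : ∀ v f K → stepℕ (returnSt v (push (callFr f) K)) ≡ evalSt f v K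
returnSt-call v f K =
  symbolic step (`returnSt (`# 0) (`push (`callFr (`# 1)) (`# 2))) (v ∷ f ∷ K ∷ [])

returnSt-rec : ∀ v h k xs K →
               stepℕ (returnSt v (push (recFr h k xs) K)) ≡ evalSt h (pair k (pair v xs)) K
returnSt-rec v h k xs K =
  symbolic step (`returnSt (`# 0) (`push (`recFr (`# 1) (`# 2) (`# 3)) (`# 4)))
                (v ∷ h ∷ k ∷ xs ∷ K ∷ [])

returnSt-search-zero : ∀ f j xs K → stepℕ (returnSt 0 (push (searchFr f j xs) K)) ≡ returnSt j K
returnSt-search-zero f j xs K =
  symbolic step (`returnSt (`lit 0) (`push (`searchFr (`# 0) (`# 1) (`# 2)) (`# 3)))
                (f ∷ j ∷ xs ∷ K ∷ [])

returnSt-search-suc : ∀ v f j xs K →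
                      stepℕ (returnSt (suc v) (push (searchFr f j xs) K))
                        ≡ evalSt f (pair (suc j) xs) (push (searchFr f (suc j) xs) K)
returnSt-search-suc v f j xs K =
  symbolic step (`returnSt (`suc (`# 0)) (`push (`searchFr (`# 1) (`# 2) (`# 3)) (`# 4)))
                (v ∷ f ∷ j ∷ xs ∷ K ∷ [])

_↠_ : ℕ → ℕ → Set
_↠_ = Star (λ s u → stepℕ s ≡ u)

mutual
  eval-↠ : ∀ {n} {e : PR n} {xs y} → Eval e xs y → ∀ K → evalSt ⌜ e ⌝ ⌜ xs ⌝ⱽ K ↠ returnSt y K
  eval-↠ {n} {xs = xs} evZ K = evalSt-Z {n} ⌜ xs ⌝ⱽ K ◅ ε
  eval-↠ (evS {x}) K = evalSt-S x K ◅ ε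
  eval-↠ (evP {i = i} {xs}) K =
    trans (evalSt-P i ⌜ xs ⌝ⱽ K) (cong (λ v → returnSt v K) (lookup-⌜⌝ⱽ xs i)) ◅ ε
  eval-↠ {xs = xs} (evC {f = f} {gs} gs⇓ f⇓) K =
    evalSt-C f gs ⌜ xs ⌝ⱽ K ◅ evalVec-↠ gs⇓ _ ◅◅ returnSt-call _ ⌜ f ⌝ K ◅ eval-↠ f⇓ K
  eval-↠ (evR0 {g = g} {h} {xs} g⇓) K = evalSt-R-zero g h ⌜ xs ⌝ⱽ K ◅ eval-↠ g⇓ K
  eval-↠ (evRs {g = g} {h} {xs} {k} {z} r⇓ h⇓) K =
    evalSt-R-suc g h k ⌜ xs ⌝ⱽ K ◅ eval-↠ r⇓ _ ◅◅ returnSt-rec z ⌜ h ⌝ k ⌜ xs ⌝ⱽ K ◅ eval-↠ h⇓ K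
  eval-↠ (evM {f = f} {xs} {k} f⇓0 below) K = evalSt-M f ⌜ xs ⌝ⱽ K ◅ search 0 k refl
    where
    search : ∀ j d → j + d ≡ k →
             evalSt ⌜ f ⌝ (pair j ⌜ xs ⌝ⱽ) (push (searchFr ⌜ f ⌝ j ⌜ xs ⌝ⱽ) K) ↠ returnSt k K
    search j zero j+0≡k with trans (sym (+-identityʳ j)) j+0≡k
    ... | refl = eval-↠ f⇓0 _ ◅◅ returnSt-search-zero ⌜ f ⌝ j ⌜ xs ⌝ⱽ K ◅ ε
    search j (suc d) j+1+d≡k =
      eval-↠ (proj₂ (below j j<k)) _ ◅◅
      returnSt-search-suc (proj₁ (below j j<k)) ⌜ f ⌝ j ⌜ xs ⌝ⱽ K ◅
      search (suc j) d (trans (sym (+-suc j d)) j+1+d≡k)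
      where
      j<k : j < k
      j<k = ≤-trans (s≤s (m≤m+n j d)) (≤-reflexive (trans (sym (+-suc j d)) j+1+d≡k))

  evalVec-↠ : ∀ {n m} {gs : Vec (PR n) m} {xs ys} → EvalVec gs xs ys →
              ∀ K → evalVecSt ⌜ gs ⌝* ⌜ xs ⌝ⱽ K ↠ returnSt ⌜ ys ⌝ⱽ K
  evalVec-↠ {xs = xs} ev[] K = evalVecSt-[] ⌜ xs ⌝ⱽ K ◅ ε
  evalVec-↠ {xs = xs} (ev∷ {g = g} {gs} {y = y} g⇓ gs⇓) K =
    evalVecSt-∷ g gs ⌜ xs ⌝ⱽ K ◅ eval-↠ g⇓ _ ◅◅ returnSt-args y ⌜ gs ⌝* ⌜ xs ⌝ⱽ K ◅
    evalVec-↠ gs⇓ _ ◅◅ returnSt-cons _ y K ◅ ε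

↠-iterate : ∀ {s u} → s ↠ u → ∃[ t ] iterate stepℕ s t ≡ u
↠-iterate ε          = 0 , refl
↠-iterate (refl ◅ p) = let t , eq = ↠-iterate p in suc t , eq

halted : Exp 1
halted = `if0 (`π₂ (`π₂ state))
               (`switch (`π₁ state) (`lit 1 ∷ `lit 1 ∷ `lit 0 ∷ `lit 1 ∷ []))
               (`lit 1)

output : Exp 1
output = `π₁ (`π₂ state)

halted-returnSt : ∀ v → ⟦ halted ⟧ (returnSt v 0 ∷ []) ≡ 0
halted-returnSt v = symbolic halted (`returnSt (`# 0) (`lit 0)) (v ∷ [])

output-returnSt : ∀ v K → ⟦ output ⟧ (returnSt v K ∷ []) ≡ v
output-returnSt v K = symbolic output (`returnSt (`# 0) (`# 1)) (v ∷ K ∷ [])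

halted-fixed : ∀ s → ⟦ halted ⟧ (s ∷ []) ≡ 0 → stepℕ s ≡ s
-- In every case but the one listed, `halts` has an absurd type.
halted-fixed s halts with π₂ (π₂ s) | π₁ s
... | zero | suc (suc zero) = refl

-- A universal function

iterate-+ : ∀ {A : Set} (f : A → A) x m n → iterate f x (m + n) ≡ iterate f (iterate f x m) n
iterate-+ f x zero    n = refl
iterate-+ f x (suc m) n = iterate-+ f (f x) m n

iterate-fixed : ∀ {A : Set} (f : A → A) {x} → f x ≡ x → ∀ n → iterate f x n ≡ x
iterate-fixed f fx≡x zero    = refl
iterate-fixed f fx≡x (suc n) rewrite fx≡x = iterate-fixed f fx≡x n

iterate-settles : ∀ {A : Set} (f : A → A) x {k t} → k ≤ t →
                  f (iterate f x k) ≡ iterate f x k → iterate f x t ≡ iterate f x k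
iterate-settles f x {k} k≤t fixed with m≤n⇒∃[o]m+o≡n k≤t
... | d , refl = trans (iterate-+ f x k d) (iterate-fixed f fixed d)

LeastZero≤ : (ℕ → ℕ) → ℕ → Set
LeastZero≤ h t = ∃[ k ] k ≤ t × h k ≡ 0 × (∀ j → j < k → ∃[ v ] h j ≡ suc v)

least-zero : (h : ℕ → ℕ) → ∀ t → h t ≡ 0 → LeastZero≤ h t
least-zero h = <-rec (λ t → h t ≡ 0 → LeastZero≤ h t) search
  where
  search : ∀ t → (∀ {j} → j < t → h j ≡ 0 → LeastZero≤ h j) → h t ≡ 0 → LeastZero≤ h t
  search t earlier ht≡0 with anyUpTo? (λ j → h j ≟ 0) t
  ... | yes (j , j<t , hj≡0) =
    let k , k≤j , rest = earlier j<t hj≡0 in k , ≤-trans k≤j (<⇒≤ j<t) , rest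
  ... | no none = t , ≤-refl , ht≡0 , λ j j<t → positive (λ hj≡0 → none (j , j<t , hj≡0))
    where
    positive : ∀ {j} → h j ≢ 0 → ∃[ v ] h j ≡ suc v
    positive {j} hj≢0 = pred (h j) , sym (suc-pred (h j) {{≢-nonZero hj≢0}})

eval-M-least : ∀ {n} {f : PR (suc n)} {xs} (h : ℕ → ℕ) → (∀ t → Eval f (t ∷ xs) (h t)) →
               ∀ t → h t ≡ 0 → ∃[ k ] k ≤ t × h k ≡ 0 × Eval (M f) xs k
eval-M-least {f = f} {xs} h f⇓ t ht≡0 =
  let k , k≤t , hk≡0 , below = least-zero h t ht≡0
  in k , k≤t , hk≡0 ,
     evM (subst (Eval f (k ∷ xs)) hk≡0 (f⇓ k))
         (λ j j<k → let v , hj≡1+v = below j j<k in v , subst (Eval f (j ∷ xs)) hj≡1+v (f⇓ j))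

initial : Exp 1 → Exp 1 → Exp 1
initial prog arg = `evalSt prog (`pair arg (`lit 0)) (`lit 0)

RUN : Exp 1 → Exp 1 → PR 2
RUN prog arg =
  C (ITERATE (compile step)) (P (# 0) ∷ C (compile (initial prog arg)) (P (# 1) ∷ []) ∷ [])

run : Exp 1 → Exp 1 → ℕ → ℕ → ℕ
run prog arg c = iterate stepℕ (⟦ initial prog arg ⟧ (c ∷ []))

eval-RUN : ∀ prog arg t c → Eval (RUN prog arg) (t ∷ c ∷ []) (run prog arg c t)
eval-RUN prog arg t c =
  eval-C₂ evP (eval-C₁ evP (eval-compile (initial prog arg) _))
          (eval-ITERATE (λ s → eval-compile step (s ∷ [])) t _)

run-reaches : ∀ prog arg {d : PR 1} {c y} → ⟦ prog ⟧ (c ∷ []) ≡ ⌜ d ⌝ →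
              Eval d (⟦ arg ⟧ (c ∷ []) ∷ []) y → ∃[ t ] run prog arg c t ≡ returnSt y 0
run-reaches prog arg {c = c} {y} prog≡d d⇓ =
  ↠-iterate (subst (λ p → evalSt p (pair (⟦ arg ⟧ (c ∷ [])) 0) 0 ↠ returnSt y 0)
                   (sym prog≡d) (eval-↠ d⇓ 0))

HALTED-AT : Exp 1 → Exp 1 → PR 2
HALTED-AT prog arg = C (compile halted) (RUN prog arg ∷ [])

eval-HALTED-AT : ∀ prog arg t c →
                 Eval (HALTED-AT prog arg) (t ∷ c ∷ []) (⟦ halted ⟧ (run prog arg c t ∷ []))
eval-HALTED-AT prog arg t c = eval-C₁ (eval-RUN prog arg t c) (eval-compile halted _)

first-halt : ∀ prog arg {c y t} → run prog arg c t ≡ returnSt y 0 →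
             ∃[ k ] Eval (M (HALTED-AT prog arg)) (c ∷ []) k × run prog arg c k ≡ returnSt y 0
first-halt prog arg {c} {y} {t} run-t =
  let halted-t = trans (cong (λ s → ⟦ halted ⟧ (s ∷ [])) run-t) (halted-returnSt y)
      k , k≤t , halted-k , μ⇓ =
        eval-M-least (λ t → ⟦ halted ⟧ (run prog arg c t ∷ [])) (λ t → eval-HALTED-AT prog arg t c)
                     t halted-t
  in k , μ⇓ , trans (sym (iterate-settles stepℕ (⟦ initial prog arg ⟧ (c ∷ [])) k≤t
                                          (halted-fixed (run prog arg c k) halted-k)))
                    run-t

interpret : Exp 1 → Exp 1 → PR 1
interpret prog arg =
  C (compile output) (C (RUN prog arg) (M (HALTED-AT prog arg) ∷ P (# 0) ∷ []) ∷ [])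

eval-interpret : ∀ prog arg {d : PR 1} {c y} → ⟦ prog ⟧ (c ∷ []) ≡ ⌜ d ⌝ →
                 Eval d (⟦ arg ⟧ (c ∷ []) ∷ []) y → Eval (interpret prog arg) (c ∷ []) y
eval-interpret prog arg {c = c} {y} prog≡d d⇓ =
  let t , run-t = run-reaches prog arg prog≡d d⇓
      k , μ⇓ , run-k = first-halt prog arg {c} {y} {t} run-t
      output≡y = trans (cong (λ s → ⟦ output ⟧ (s ∷ [])) run-k) (output-returnSt y 0)
  in eval-C₁ (eval-C₂ μ⇓ evP (eval-RUN prog arg k c))
             (subst (Eval (compile output) (run prog arg c k ∷ [])) output≡y
                    (eval-compile output _))

-- Relative computations

mutual
  eval-functional : ∀ {n} {e : PR n} {xs y y′} → Eval e xs y → Eval e xs y′ → y ≡ y′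
  eval-functional evZ        evZ          = refl
  eval-functional evS        evS          = refl
  eval-functional evP        evP          = refl
  eval-functional (evC a b)  (evC a′ b′)  with evalVec-functional a a′
  ... | refl = eval-functional b b′
  eval-functional (evR0 a)   (evR0 a′)    = eval-functional a a′
  eval-functional (evRs a b) (evRs a′ b′) with eval-functional a a′
  ... | refl = eval-functional b b′
  eval-functional (evM {k = k} zero-k below) (evM {k = k′} zero-k′ below′) with <-cmp k k′
  ... | tri< k<k′ _ _ with eval-functional zero-k (proj₂ (below′ k k<k′))
  ...   | ()
  eval-functional (evM _ _) (evM _ _) | tri≈ _ k≡k′ _ = k≡k′
  eval-functional (evM {k = k} zero-k below) (evM {k = k′} zero-k′ below′) | tri> _ _ k′<k
    with eval-functional zero-k′ (proj₂ (below k′ k′<k))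
  ...   | ()

  evalVec-functional : ∀ {n m} {gs : Vec (PR n) m} {xs ys ys′} →
                       EvalVec gs xs ys → EvalVec gs xs ys′ → ys ≡ ys′
  evalVec-functional ev[]       ev[]         = refl
  evalVec-functional (ev∷ a as) (ev∷ a′ as′) =
    cong₂ _∷_ (eval-functional a a′) (evalVec-functional as as′)

length-snoc : ∀ (as : List ℕ) a → length (as ++ [ a ]) ≡ suc (length as)
length-snoc as a = trans (length-++ as) (+-comm (length as) 1)

module _ {e : PR 1} {g : PFun} {n : ℕ} where

  history-unique : ∀ {as bs} → History e g n as → History e g n bs → length as ≡ length bs → as ≡ bs
  history-unique h[] h[] _ = refl
  history-unique h[] (hsnoc {as} {_} {a} _ _ _) eq with trans eq (length-snoc as a)
  ... | ()
  history-unique (hsnoc {as} {_} {a} _ _ _) h[] eq with trans (sym (length-snoc as a)) eq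
  ... | ()
  history-unique (hsnoc {as} {q} {a} H asks-q q↦a) (hsnoc {bs} {q′} {b} H′ asks-q′ q′↦b) eq
    with history-unique H H′
           (suc-injective (trans (sym (length-snoc as a)) (trans eq (length-snoc bs b))))
  ... | refl with *-cancelˡ-≡ q q′ 2 (eval-functional asks-q asks-q′)
  ... | refl = cong (λ u → as ++ [ u ]) (functional g q↦a q′↦b)

  history-query : ∀ {bs} → History e g n bs → ∀ l → l < length bs →
                  ∃[ cs ] ∃[ q ] History e g n cs × length cs ≡ l × Φ⟨ e ⟩ (n ∷ cs) (2 * q)
  history-query (hsnoc {as} {q} {a} H asks-q _) l l<len
    with m≤n⇒m<n∨m≡n (≤-pred (≤-trans l<len (≤-reflexive (length-snoc as a))))
  ... | inj₁ l<len′ = history-query H l l<len′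
  ... | inj₂ refl   = as , q , H , refl , asks-q

  halted-history-maximal : ∀ {as bs y} → History e g n as → Φ⟨ e ⟩ (n ∷ as) (suc (2 * y)) →
                           History e g n bs → length as < length bs → ⊥
  halted-history-maximal {as} {y = y} H halts H′ as<bs with history-query H′ (length as) as<bs
  ... | cs , q , Hc , len≡ , asks with history-unique Hc H len≡
  ...   | refl = even≢odd q y (eval-functional asks halts)

  relComp-functional : ∀ {y y′} → RelComp e g n y → RelComp e g n y′ → y ≡ y′
  relComp-functional {y} {y′} (as , H , halts) (bs , H′ , halts′) with <-cmp (length as) (length bs)
  ... | tri< as<bs _ _ = ⊥-elim (halted-history-maximal {y = y} H halts H′ as<bs)
  ... | tri> _ _ bs<as = ⊥-elim (halted-history-maximal {y = y′} H′ halts′ H bs<as)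
  ... | tri≈ _ eq _ with history-unique H H′ eq
  ...   | refl = *-cancelˡ-≡ y y′ 2 (suc-injective (eval-functional halts halts′))

Φ-compile : ∀ (t : Exp 1) {s v} → ⟦ t ⟧ (code s ∷ []) ≡ v → Φ⟨ compile t ⟩ s v
Φ-compile t ⟦t⟧≡v = subst (Eval (compile t) _) ⟦t⟧≡v (eval-compile t _)

-- π₂ state is 0 before the first oracle answer a, and pair a 0 after it.
askOnce : Exp 1 → Exp 1
askOnce Q = `if0 (`π₂ state) (`double (Q ⟨ `π₁ state ∷ [] ⟩)) (`suc (`double (`π₁ (`π₂ state))))

relComp-askOnce : ∀ Q g n y → graph g (⟦ Q ⟧ (n ∷ [])) y → RelComp (compile (askOnce Q)) g n y
relComp-askOnce Q g n y q↦y =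
  y ∷ [] , hsnoc h[] (Φ-compile (askOnce Q) {n ∷ []} asks) q↦y ,
  Φ-compile (askOnce Q) {n ∷ y ∷ []} answers
  where
  open ≡-Reasoning
  Q′ : Exp 1
  Q′ = Q ⟨ `π₁ state ∷ [] ⟩
  asks : ⟦ askOnce Q ⟧ (code (n ∷ []) ∷ []) ≡ 2 * ⟦ Q ⟧ (n ∷ [])
  asks = begin
    ⟦ askOnce Q ⟧ (code (n ∷ []) ∷ [])
      ≡⟨ cong (λ c → ⟦ askOnce Q ⟧ (c ∷ [])) (code-∷ n []) ⟩
    ⟦ askOnce Q ⟧ (pair n 0 ∷ [])
      ≡⟨ cong (λ z → if0 z (2 * ⟦ Q′ ⟧ (pair n 0 ∷ [])) (suc (2 * π₁ (π₂ (pair n 0)))))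
              (π₂-pair n 0) ⟩
    2 * ⟦ Q′ ⟧ (pair n 0 ∷ [])
      ≡⟨ cong (2 *_) (⟦⟨⟩⟧ Q _ _) ⟩
    2 * ⟦ Q ⟧ (π₁ (pair n 0) ∷ [])
      ≡⟨ cong (λ m → 2 * ⟦ Q ⟧ (m ∷ [])) (π₁-pair n 0) ⟩
    2 * ⟦ Q ⟧ (n ∷ [])
      ∎
  answers : ⟦ askOnce Q ⟧ (code (n ∷ y ∷ []) ∷ []) ≡ suc (2 * y)
  answers = begin
    ⟦ askOnce Q ⟧ (code (n ∷ y ∷ []) ∷ [])
      ≡⟨ cong (λ c → ⟦ askOnce Q ⟧ (c ∷ []))
              (trans (code-∷ n (y ∷ [])) (cong (pair n) (code-∷ y []))) ⟩
    ⟦ askOnce Q ⟧ (pair n (pair y 0) ∷ [])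
      ≡⟨ symbolic (askOnce Q) (`pair (`# 0) (`pair (`# 1) (`lit 0))) (n ∷ y ∷ []) ⟩
    suc (2 * y)
      ∎

relComp-interpret : ∀ prog arg {d : PR 1} {m n g y} →
                    (∀ c → ⟦ prog ⟧ (pair m c ∷ []) ≡ ⌜ d ⌝) →
                    (∀ c → ⟦ arg ⟧ (pair m c ∷ []) ≡ pair n c) →
                    RelComp d g n y → RelComp (interpret prog arg) g m y
relComp-interpret prog arg {d} {m} {n} {g} prog≡d arg≡ (as , H , halts) =
  as , history H , simulate {as} halts
  where
  simulate : ∀ {as v} → Φ⟨ d ⟩ (n ∷ as) v → Φ⟨ interpret prog arg ⟩ (m ∷ as) v
  simulate {as} {v} d⇓ =
    subst (λ c → Eval (interpret prog arg) (c ∷ []) v) (sym (code-∷ m as))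
      (eval-interpret prog arg (prog≡d (code as))
        (subst (λ c → Eval d (c ∷ []) v) (trans (code-∷ n as) (sym (arg≡ (code as)))) d⇓))
  history : ∀ {as} → History d g n as → History (interpret prog arg) g m as
  history h[]                     = h[]
  history (hsnoc {as} H asks q↦a) = hsnoc (history H) (simulate {as} asks) q↦a

-- Joins and meets

pair-injective : ∀ {a b a′ b′} → pair a b ≡ pair a′ b′ → a ≡ a′ × b ≡ b′
pair-injective {a} {b} {a′} {b′} eq =
  trans (sym (π₁-pair a b)) (trans (cong π₁ eq) (π₁-pair a′ b′)) ,
  trans (sym (π₂-pair a b)) (trans (cong π₂ eq) (π₂-pair a′ b′))

join : PFun → PFun → PFun
join f g = record { graph = ⊕-graph ; functional = ⊕-functional }
  where
  ⊕-graph : ℕ → ℕ → Set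
  ⊕-graph m y = (∃[ n ] m ≡ pair 0 n × graph f n y) ⊎ (∃[ n ] m ≡ pair 1 n × graph g n y)
  ⊕-functional : ∀ {m y y′} → ⊕-graph m y → ⊕-graph m y′ → y ≡ y′
  ⊕-functional (inj₁ (_ , refl , x)) (inj₁ (_ , eq , x′)) with pair-injective eq
  ... | _ , refl = functional f x x′
  ⊕-functional (inj₂ (_ , refl , x)) (inj₂ (_ , eq , x′)) with pair-injective eq
  ... | _ , refl = functional g x x′
  ⊕-functional (inj₁ (_ , refl , _)) (inj₂ (_ , eq , _)) with pair-injective eq
  ... | () , _
  ⊕-functional (inj₂ (_ , refl , _)) (inj₁ (_ , eq , _)) with pair-injective eq
  ... | () , _

join-isJoin : ∀ f g → IsJoin f g (join f g)
join-isJoin f g =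
  (compile (askOnce (tagged 0)) ,
   λ n y x → relComp-askOnce (tagged 0) (join f g) n y (inj₁ (n , refl , x))) ,
  (compile (askOnce (tagged 1)) ,
   λ n y x → relComp-askOnce (tagged 1) (join f g) n y (inj₂ (n , refl , x))) ,
  least
  where
  tagged : ℕ → Exp 1
  tagged i = `pair (`lit i) (`# 0)
  least : ∀ k → f ≤subT k → g ≤subT k → join f g ≤subT k
  least k (d₀ , f≤k) (d₁ , g≤k) = interpret prog arg , reduce
    where
    prog arg : Exp 1
    prog = `if0 (`π₁ (`π₁ state)) (`lit ⌜ d₀ ⌝) (`lit ⌜ d₁ ⌝)
    arg  = `pair (`π₂ (`π₁ state)) (`π₂ state)
    input : ℕ → Exp 2
    input i = `pair (tagged i ⟨ `# 0 ∷ [] ⟩) (`# 1)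
    reduce : ∀ m y → graph (join f g) m y → RelComp (interpret prog arg) k m y
    reduce _ y (inj₁ (n , refl , x)) =
      relComp-interpret prog arg {d₀} {y = y} (λ c → symbolic prog (input 0) (n ∷ c ∷ []))
                        (λ c → symbolic arg (input 0) (n ∷ c ∷ [])) (f≤k n y x)
    reduce _ y (inj₂ (n , refl , x)) =
      relComp-interpret prog arg {d₁} {y = y} (λ c → symbolic prog (input 1) (n ∷ c ∷ []))
                        (λ c → symbolic arg (input 1) (n ∷ c ∷ [])) (g≤k n y x)

-- On the input ⟨⟨d,⟨e,n⟩⟩, as⟩ these read off d, e and ⟨n, as⟩.
progˡ progʳ argᵐ : Exp 1
progˡ = `π₁ (`π₁ state)
progʳ = `π₁ (`π₂ (`π₁ state))
argᵐ  = `pair (`π₂ (`π₂ (`π₁ state))) (`π₂ state)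

meet : PFun → PFun → PFun
meet f g = record
  { graph      = λ m y → RelComp (interpret progˡ argᵐ) f m y × RelComp (interpret progʳ argᵐ) g m y
  ; functional = λ both both′ → relComp-functional (proj₁ both) (proj₁ both′)
  }

meet-isMeet : ∀ f g → IsMeet f g (meet f g)
meet-isMeet f g =
  (interpret progˡ argᵐ , λ _ _ → proj₁) , (interpret progʳ argᵐ , λ _ _ → proj₂) , greatest
  where
  greatest : ∀ k → k ≤subT f → k ≤subT g → k ≤subT meet f g
  greatest k (d , k≤f) (e , k≤g) = compile (askOnce query) , reduce
    where
    query : Exp 1
    query = `pair (`lit ⌜ d ⌝) (`pair (`lit ⌜ e ⌝) (`# 0))
    input : Exp 2
    input = `pair (query ⟨ `# 0 ∷ [] ⟩) (`# 1)
    reduce : ∀ n y → graph k n y → RelComp (compile (askOnce query)) (meet f g) n y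
    reduce n y k↦y = relComp-askOnce query (meet f g) n y
      ( relComp-interpret progˡ argᵐ {d} {y = y} (λ c → symbolic progˡ input (n ∷ c ∷ []))
                          (λ c → symbolic argᵐ input (n ∷ c ∷ [])) (k≤f n y k↦y)
      , relComp-interpret progʳ argᵐ {e} {y = y} (λ c → symbolic progʳ input (n ∷ c ∷ []))
                          (λ c → symbolic argᵐ input (n ∷ c ∷ [])) (k≤g n y k↦y) )

proposition3p1 : (f g : PFun) →
    Σ PFun (λ j → IsJoin f g j) × Σ PFun (λ m → IsMeet f g m)
proposition3p1 f g = (join f g , join-isJoin f g) , (meet f g , meet-isMeet f g)
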